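{- Let $P$ be a combinatorial specification all of whose rules are produced by productive strategies. Then the reliance graph of $P$ has no infinite directed walk.
   Context: A combinatorial set is a set of objects each with a size in $\mathbb{N}$, finitely many of each size; $\mathcal{A}_n$ denotes its objects of size $n$. An $m$-ary combinatorial strategy $S$ ($m\ge0$) consists of: a decomposition function $d_S$ sending each combinatorial set either to an $m$-tuple of combinatorial sets or to the symbol DNA; a reliance profile function $r_S:\mathbb{N}\to\mathbb{Z}^m$, $r_S(n)=(r^{(1)}_S(n),\ldots,r^{(m)}_S(n))$; and counting functions $c_{S,(n)}$ such that whenever $d_S(\mathcal{A})=(\mathcal{B}^{(1)},\ldots,\mathcal{B}^{(m)})$, $c_{S,(n)}$ applied to the tuples $(|\mathcal{B}^{(i)}_0|,\ldots,|\mathcal{B}^{(i)}_{r^{(i)}_S(n)}|)$, $i=1,\ldots,m$, equals $|\mathcal{A}_n|$. If $d_S(\mathcal{A})=(\mathcal{B}^{(1)},\ldots,\mathcal{B}^{(m)})$ we get the rule $\mathcal{A}\xleftarrow{S}(\mathcal{B}^{(1)},\ldots,\mathcal{B}^{(m)})$, and we say $\mathcal{A}_N$ relies on $\mathcal{B}^{(i)}_j$ if $0\le j\le r^{(i)}_S(N)$. A combinatorial specification is a set of rules such that every set appearing on a right-hand side is the left-hand side of exactly one rule. The reliance graph of a specification has vertices $\mathcal{B}_k$ for every set $\mathcal{B}$ of the specification and every $k\in\mathbb{N}$, and an edge $\mathcal{A}_N\to\mathcal{B}^{(i)}_j$ whenever $\mathcal{A}\xleftarrow{S}(\mathcal{B}^{(1)},\ldots,\mathcal{B}^{(m)})$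 is the rule with left-hand side $\mathcal{A}$ and $\mathcal{A}_N$ relies on $\mathcal{B}^{(i)}_j$. A strategy $S$ is productive if for every combinatorial set $\mathcal{A}$ with $d_S(\mathcal{A})=(\mathcal{B}^{(1)},\ldots,\mathcal{B}^{(m)})$ and every $i\in\{1,\ldots,m\}$: (1) for all $N\in\mathbb{N}$, if $\mathcal{A}_N$ relies on $\mathcal{B}^{(i)}_j$ then $j\le N$; (2) if $\mathcal{A}_N$ relies on $\mathcal{B}^{(i)}_N$ for some $N$, then (a) $|\mathcal{A}_n|\ge|\mathcal{B}^{(i)}_n|$ for all $n\in\mathbb{N}$ and (b) $|\mathcal{A}_\ell|>|\mathcal{B}^{(i)}_\ell|$ for some $\ell\in\mathbb{N}$. -}

module Defs where

open import Data.Nat using (ℕ; zero; suc; _≤_; _<_)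
open import Data.Integer using (ℤ; +_; -[1+_]) renaming (_≤_ to _≤ℤ_)
open import Data.Fin using (Fin; toℕ)
open import Data.Vec using (Vec; tabulate)
open import Data.Maybe using (Maybe; just; nothing)
open import Data.List using (List)
open import Data.List.Membership.Propositional using (_∈_)
open import Data.Product using (Σ; ∃; ∃-syntax; _×_; _,_)
open import Function.Bundles using (_↔_)
open import Relation.Binary.PropositionalEquality using (_≡_)

record CombSet : Set₁ where
  field
    Obj  : Set
    size : Obj → ℕ
    card : ℕ → ℕ
    enum : (n : ℕ) → Fin (card n) ↔ Σ Obj (λ o → size o ≡ n)
open CombSet public

∣_∣ₙ : CombSet → ℕ → ℕ
∣ A ∣ₙ = card A

-- length of the tuple (|B_0|, …, |B_r|); empty when r < 0
tupleLen : ℤ → ℕ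
tupleLen (+ k)      = suc k
tupleLen -[1+ _ ]   = 0

countTuple : (B : CombSet) (r : ℤ) → Vec ℕ (tupleLen r)
countTuple B r = tabulate (λ j → card B (toℕ j))

-- An m-ary combinatorial strategy.  d A ≡ nothing encodes "DNA".
record Strategy (m : ℕ) : Set₁ where
  field
    d : CombSet → Maybe (Fin m → CombSet)
    r : ℕ → Fin m → ℤ
    c : (n : ℕ) → ((i : Fin m) → Vec ℕ (tupleLen (r n i))) → ℕ
    c-correct : (A : CombSet) (Bs : Fin m → CombSet) → d A ≡ just Bs →
                (n : ℕ) → c n (λ i → countTuple (Bs i) (r n i)) ≡ card A n
open Strategy public

-- A_N relies on B^(i)_j  (0 ≤ j ≤ r^(i)_S(N); j ∈ ℕ so 0 ≤ j is automatic)
Relies : {m : ℕ} → Strategy m → (N : ℕ) → Fin m → (j : ℕ) → Set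
Relies S N i j = (+ j) ≤ℤ r S N i

Productive : {m : ℕ} → Strategy m → Set₁
Productive {m} S =
  (A : CombSet) (Bs : Fin m → CombSet) → d S A ≡ just Bs → (i : Fin m) →
    ((N j : ℕ) → Relies S N i j → j ≤ N) ×
    ((∃[ N ] Relies S N i N) →
       ((n : ℕ) → card (Bs i) n ≤ card A n) × (∃[ ℓ ] card (Bs i) ℓ < card A ℓ))

record Rule : Set₁ where
  field
    arity : ℕ
    strat : Strategy arity
    lhs   : CombSet
    rhs   : Fin arity → CombSet
    valid : d strat lhs ≡ just rhs
open Rule public

IsSpecification : List Rule → Set₁
IsSpecification P =
  (ρ : Rule) → ρ ∈ P → (i : Fin (arity ρ)) →
    Σ Rule (λ ρ′ → ρ′ ∈ P × lhs ρ′ ≡ rhs ρ i ×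
      ((ρ″ : Rule) → ρ″ ∈ P → lhs ρ″ ≡ rhs ρ i → ρ″ ≡ ρ′))

RelianceEdge : List Rule → CombSet × ℕ → CombSet × ℕ → Set₁
RelianceEdge P (A , N) (B , j) =
  Σ Rule (λ ρ → ρ ∈ P × lhs ρ ≡ A ×
    Σ (Fin (arity ρ)) (λ i → rhs ρ i ≡ B × Relies (strat ρ) N i j))

InfiniteWalk : List Rule → Set₁
InfiniteWalk P =
  Σ (ℕ → CombSet × ℕ) (λ v → (k : ℕ) → RelianceEdge P (v k) (v (suc k)))

-- Along any walk of the reliance graph the size index never increases, so along
-- an infinite walk it is eventually constant (constructively: it is not the case
-- that it never stabilises, which suffices to refute the walk).  On a constant
-- stretch every step is a reliance of A_N on B_N, so productivity makes the
-- counting sequence of the next set pointwise ≤ and somewhere < that of the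
-- previous one.  But the sets visited are left-hand sides of the finitely many
-- rules of P, so some set repeats, and its counting sequence would be strictly
-- below itself.
module Submission where

open import Defs
open import Data.Empty using (⊥)
open import Data.Fin using (toℕ)
open import Data.Fin.Properties using (pigeonhole)
open import Data.List using (List; length; lookup; map)
open import Data.List.Membership.Propositional using (_∈_)
open import Data.List.Membership.Propositional.Properties using (∈-map⁺)
open import Data.List.Relation.Unary.Any using (index)
open import Data.List.Relation.Unary.Any.Properties using (lookup-index)
open import Data.Nat using (ℕ; zero; suc; _+_; _≤_; _<_; s≤s)
open import Data.Nat.Induction using (<-wellFounded)
open import Data.Nat.Properties using (≤-trans; ≤-reflexive; ≤-antisym; <-≤-trans; <-irrefl; ≮⇒≥; m≤n⇒m<n∨m≡n; n<1+n)
open import Data.Product using (∃-syntax; _×_; _,_; proj₁; proj₂)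
open import Data.Sum using (inj₁; inj₂)
open import Function using (_∘_)
open import Induction.WellFounded using (Acc; acc)
open import Level using (Level)
open import Relation.Binary.Core using (Rel)
open import Relation.Binary.Definitions using (Transitive; Irreflexive)
open import Relation.Binary.PropositionalEquality using (_≡_; refl; sym; trans; cong)
open import Relation.Nullary using (¬_)

Nonincreasing : (ℕ → ℕ) → Set
Nonincreasing f = ∀ k → f (suc k) ≤ f k

EventuallyConstant : (ℕ → ℕ) → Set
EventuallyConstant f = ∃[ K ] ∀ k → f (suc k + K) ≡ f (k + K)

nonincreasing⇒¬¬eventuallyConstant : ∀ f → Nonincreasing f → ¬ ¬ EventuallyConstant f
nonincreasing⇒¬¬eventuallyConstant f f↓ = from 0 (<-wellFounded (f 0))
  where
  from : ∀ K → Acc _<_ (f K) → ¬ ¬ EventuallyConstant f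
  from K (acc smaller) notEC = notEC (K , λ k → trans (stays (suc k)) (sym (stays k)))
    where
    noDrop : ¬ (∃[ k ] f (k + K) < f K)
    noDrop (k , drop) = from (k + K) (smaller drop) notEC

    stays : ∀ k → f (k + K) ≡ f K
    stays zero    = refl
    stays (suc k) = ≤-antisym (≤-trans (f↓ (k + K)) (≤-reflexive (stays k)))
                              (≮⇒≥ λ drop → noDrop (suc k , drop))

module _ {a ℓ : Level} {A : Set a} {_<ₐ_ : Rel A ℓ}
         (<ₐ-trans : Transitive _<ₐ_) (<ₐ-irrefl : Irreflexive _≡_ _<ₐ_) where

  descending⇒decreasing : (f : ℕ → A) → (∀ k → f (suc k) <ₐ f k) →
                          ∀ {i j} → i < j → f j <ₐ f i
  descending⇒decreasing f f↓ {j = suc j} (s≤s i≤j) with m≤n⇒m<n∨m≡n i≤j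
  ... | inj₁ i<j  = <ₐ-trans (f↓ j) (descending⇒decreasing f f↓ i<j)
  ... | inj₂ refl = f↓ j

  ¬descending-in-finite : (xs : List A) (f : ℕ → A) → (∀ k → f k ∈ xs) →
                          ¬ (∀ k → f (suc k) <ₐ f k)
  ¬descending-in-finite xs f f∈xs f↓
    with i , j , i<j , same-index ← pigeonhole (n<1+n (length xs)) (index ∘ f∈xs ∘ toℕ)
    = <ₐ-irrefl fi≡fj (descending⇒decreasing f f↓ i<j)
    where
    fi≡fj : f (toℕ j) ≡ f (toℕ i)
    fi≡fj = trans (lookup-index (f∈xs (toℕ j)))
              (trans (cong (lookup xs) (sym same-index)) (sym (lookup-index (f∈xs (toℕ i)))))

_⊏_ : (ℕ → ℕ) → (ℕ → ℕ) → Set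
f ⊏ g = (∀ n → f n ≤ g n) × ∃[ ℓ ] f ℓ < g ℓ

⊏-trans : Transitive _⊏_
⊏-trans (f≤g , ℓ , fℓ<gℓ) (g≤h , _) = (λ n → ≤-trans (f≤g n) (g≤h n)) , ℓ , <-≤-trans fℓ<gℓ (g≤h ℓ)

⊏-irrefl : Irreflexive _≡_ _⊏_
⊏-irrefl refl (_ , _ , fℓ<fℓ) = <-irrefl refl fℓ<fℓ

module _ (P : List Rule) (productive : (ρ : Rule) → ρ ∈ P → Productive (strat ρ)) where

  Walk : (ℕ → CombSet × ℕ) → Set₁
  Walk v = ∀ k → RelianceEdge P (v k) (v (suc k))

  edge-size-≤ : ∀ {A N B j} → RelianceEdge P (A , N) (B , j) → j ≤ N
  edge-size-≤ (ρ , ρ∈P , refl , i , refl , relies) =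
    proj₁ (productive ρ ρ∈P (lhs ρ) (rhs ρ) (valid ρ) i) _ _ relies

  edge-same-size-⊏ : ∀ {A N B j} → RelianceEdge P (A , N) (B , j) → j ≡ N → card B ⊏ card A
  edge-same-size-⊏ {N = N} (ρ , ρ∈P , refl , i , refl , relies) refl =
    proj₂ (productive ρ ρ∈P (lhs ρ) (rhs ρ) (valid ρ) i) (N , relies)

  edge-source-card∈ : ∀ {A N y} → RelianceEdge P (A , N) y → card A ∈ map (card ∘ lhs) P
  edge-source-card∈ (ρ , ρ∈P , refl , _) = ∈-map⁺ (card ∘ lhs) ρ∈P

  ¬walk-at-constant-size : ∀ {v} → Walk v → (∀ k → proj₂ (v (suc k)) ≡ proj₂ (v k)) → ⊥
  ¬walk-at-constant-size {v} edge constant =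
    ¬descending-in-finite ⊏-trans ⊏-irrefl (map (card ∘ lhs) P) (card ∘ proj₁ ∘ v)
      (λ k → edge-source-card∈ (edge k)) (λ k → edge-same-size-⊏ (edge k) (constant k))

theorem4p4 : (P : List Rule) → IsSpecification P →
    ((ρ : Rule) → ρ ∈ P → Productive (strat ρ)) →
    ¬ InfiniteWalk P
theorem4p4 P _ productive (v , edge) =
  nonincreasing⇒¬¬eventuallyConstant (proj₂ ∘ v) (λ k → edge-size-≤ P productive (edge k))
    λ (K , constant) → ¬walk-at-constant-size P productive (λ k → edge (k + K)) constant
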